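{- Let $n$ be a positive integer, $m=2n-1$ if $n$ is even and $m=2n$ if $n$ is odd. Let $\alpha,\beta,\epsilon$ be constants and $c(n),f(n)$ be functions of $n$ (with $f(n)>0$) such that $$m-\beta m-2\alpha m-2c(n)-\frac{2n\,c(n)}{f(n)}\ge 1.$$ Let $\varphi$ be an $\alpha$-dense $m$-edge precoloring of $K_{2n}$, let $L$ be a $\beta$-sparse list assignment for $K_{2n}$ from $\{1,\dots,m\}$ with $\varphi(e)\notin L(e)$ for every edge $e$ colored under $\varphi$. Let $h'$ be a proper $m$-edge coloring of $K_{2n}$ in which every edge of $K_{n,n}$ receives a color in $\{1,\dots,n\}$ and every edge of $G_1$ and of $G_2$ receives a color in $\{n+1,\dots,m\}$, and which satisfies: (a) all edges of $K_{n,n}$, except at most $3n+7$, belong to at least $\lfloor n/2\rfloor-\epsilon n$ allowed strong $2$-colored $4$-cycles; (b) each vertex of $K_{n,n}$ is incident to at most $c(n)/2$ conflict edges of $K_{n,n}$; (c) for each color $c\in\{1,\dots,n\}$, at most $c(n)$ edges of $K_{n,n}$ colored $c$ under $h'$ are conflict edges; (d) for each color $c\in\{1,\dots,n\}$, at most $c(n)$ edges of $K_{n,n}$ colored $c$ under $h'$ are colored under $\varphi$; (e) for each pair of colors $c_1\in\{1,\dots,m\}$, $c_2\in\{1,\dots,n\}$, at most $c(n)$ edges $e$ of $K_{n,n}$ have $h'(e)=c_2$ and $c_1\in L(e)$; (f) for $i=1,2$, each vertex of $G_i$ is incident to at most $c(n)/2$ conflict edges of $G_i$; (g) for $i=1,2$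 and each color $c\in\{n+1,\dots,m\}$, at most $c(n)$ edges of $G_i$ colored $c$ under $h'$ are conflict edges; (h) for $i=1,2$ and each color $c\in\{n+1,\dots,m\}$, at most $c(n)$ edges of $G_i$ colored $c$ under $h'$ are colored under $\varphi$; (i) for $i=1,2$ and each pair of colors $c_1\in\{1,\dots,m\}$, $c_2\in\{n+1,\dots,m\}$, at most $c(n)$ edges $e$ of $G_i$ have $h'(e)=c_2$ and $c_1\in L(e)$. Then there is a proper $m$-edge precoloring $\varphi'$ of $K_{2n}$ such that: (1) $\varphi'(uv)=\varphi(uv)$ for every edge $uv$ colored under $\varphi$; (2) every conflict edge $uv$ of $h'$ that is not colored under $\varphi$ is colored under $\varphi'$, and $\varphi'(uv)\notin L(uv)$; (3) at each vertex of $K_{2n}$ there are at most $\alpha m+c(n)$ edges colored under $\varphi'$; (4) for each $i\in\{1,\dots,m\}$, at most $\alpha m+f(n)$ edges have $\varphi'$-color $i$; (5) for each color $c\in\{1,\dots,n\}$, at most $2c(n)$ edges of $K_{n,n}$ that are colored under $\varphi'$ have $h'$-color $c$; (6) for each color $c\in\{n+1,\dots,m\}$ and $i=1,2$, at most $2c(n)$ edges of $G_i$ that are colored under $\varphi'$ have $h'$-color $c$.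
   Context: The vertex set of $K_{2n}$ is $\{p_1,\dots,p_n,q_1,\dots,q_n\}$; $G_1$ and $G_2$ are the subgraphs induced by $\{p_1,\dots,p_n\}$ and $\{q_1,\dots,q_n\}$ respectively, and $K_{n,n}$ is the complete bipartite subgraph with parts $\{p_1,\dots,p_n\}$ and $\{q_1,\dots,q_n\}$. An $m$-edge precoloring is a proper edge coloring with colors from $\{1,\dots,m\}$ of a subset of the edges. A partial edge coloring of $K_{2n}$ with colors $1,\dots,m$ is $\alpha$-dense if every color appears on at most $\alpha m$ edges and at most $\alpha m$ colored edges are incident to each vertex. A list assignment $L$ (sets $L(e)\subseteq\{1,\dots,m\}$) is $\beta$-sparse if $|L(e)|\le\beta m$ for every edge and, at every vertex $v$, each color lies in $L(e)$ for at most $\beta m$ edges $e$ incident to $v$. An edge $e$ is a conflict edge of $h'$ if $h'(e)\in L(e)$. A $4$-cycle $uvztu$ that is $2$-colored under $h'$ is allowed if interchanging the two colors on it gives a proper edge coloring in which none of $uv,vz,zt,tu$ is a conflict edge; a $2$-colored $4$-cycle with colors $c_1,c_2$ is strong if exactly one of $c_1,c_2$ lies in $\{1,\dots,\lfloor n/2\rfloor\}$.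
   Formalization: The constants α, β, ε are rational, and the functions $c(n)$ and $f(n)$ take only rational values. -}

module Defs where

open import Data.Nat as ℕ using (ℕ; zero; suc; _+_; _*_; _∸_; _≤_; _<_; _%_; _/_; _≡ᵇ_)
open import Data.Integer using (+_)
open import Data.Rational as ℚ using (ℚ)
open import Data.Fin using (Fin; toℕ; _≟_)
open import Data.Bool using (Bool; true; false; if_then_else_; _∧_; _∨_; not)
open import Data.Maybe using (Maybe; just)
open import Data.Product using (Σ; _×_; _,_; ∃)
open import Data.Sum using (_⊎_)
open import Data.List using (List; length)
open import Data.List.Relation.Unary.All using (All)
open import Data.List.Relation.Unary.Unique.Propositional using (Unique)
open import Relation.Nullary using (¬_; does)
open import Relation.Binary.PropositionalEquality using (_≡_; _≢_)

⟦_⟧ : ℕ → ℚ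
⟦ k ⟧ = (+ k) ℚ./ 1

mOf : ℕ → ℕ
mOf n = if (n % 2 ≡ᵇ 0) then (2 * n ∸ 1) else 2 * n

-- Vertices of K_{2n}: Fin (n + n); p_i = i (toℕ < n), q_i = n + i (toℕ ≥ n).
-- (wrapped in a record so that n can be inferred from the vertex type)
record V (n : ℕ) : Set where
  constructor vtx
  field idx : Fin (n + n)
open V public

side : ∀ {n} → V n → Bool
side {n} v = toℕ (idx v) ℕ.<ᵇ n

Knn : ∀ {n} → V n → V n → Set
Knn u v = side u ≢ side v

-- uv is an edge of G_1 (s = true) or G_2 (s = false)  (u ≠ v required separately)
InG : ∀ {n} → Bool → V n → V n → Set
InG s u v = (side u ≡ s) × (side v ≡ s)

InRange : ℕ → ℕ → ℕ → Set
InRange a b c = (a ≤ c) × (c ≤ b)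

AtMost : {A : Set} → (A → Set) → ℚ → Set
AtMost {A} P b = (xs : List A) → Unique xs → All P xs → ⟦ length xs ⟧ ℚ.≤ b

AtLeast : {A : Set} → (A → Set) → ℚ → Set
AtLeast {A} P b = Σ (List A) λ xs → Unique xs × All P xs × (b ℚ.≤ ⟦ length xs ⟧)

EdgeAtMost : ∀ {n} → (V n → V n → Set) → ℚ → Set
EdgeAtMost {n} P b = AtMost {V n × V n} (λ { (u , v) → (toℕ (idx u) < toℕ (idx v)) × P u v }) b

IncAtMost : ∀ {n} → V n → (V n → V n → Set) → ℚ → Set
IncAtMost {n} v P b = AtMost {V n} (λ w → (w ≢ v) × P v w) b

-- Colorings. An (edge-)coloring is a symmetric function on pairs of
-- vertices; its values on the diagonal are irrelevant.

PartialColoring : ℕ → Set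
PartialColoring n = V n → V n → Maybe ℕ

TotalColoring : ℕ → Set
TotalColoring n = V n → V n → ℕ

ListAssignment : ℕ → Set
ListAssignment n = V n → V n → ℕ → Bool

Colored : ∀ {n} → PartialColoring n → V n → V n → Set
Colored φ u v = ∃ λ c → φ u v ≡ just c

IsPrecoloring : ∀ {n} → ℕ → PartialColoring n → Set
IsPrecoloring {n} m φ =
  (∀ (u v : V n) → φ u v ≡ φ v u) ×
  (∀ (u v : V n) c → u ≢ v → φ u v ≡ just c → InRange 1 m c) ×
  (∀ (u v w : V n) c → u ≢ v → u ≢ w → v ≢ w → φ u v ≡ just c → φ u w ≡ just c → ⊥')
  where open import Data.Empty renaming (⊥ to ⊥')

IsProperColoring : ∀ {n} → ℕ → TotalColoring n → Set
IsProperColoring {n} m h =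
  (∀ (u v : V n) → h u v ≡ h v u) ×
  (∀ (u v : V n) → u ≢ v → InRange 1 m (h u v)) ×
  (∀ (u v w : V n) → u ≢ v → u ≢ w → v ≢ w → h u v ≢ h u w)

IsListAssignment : ∀ {n} → ℕ → ListAssignment n → Set
IsListAssignment {n} m L =
  (∀ (u v : V n) c → L u v c ≡ L v u c) ×
  (∀ (u v : V n) c → u ≢ v → L u v c ≡ true → InRange 1 m c)

Dense : ∀ {n} → ℕ → ℚ → PartialColoring n → Set
Dense {n} m α φ =
  (∀ c → EdgeAtMost {n} (λ u v → φ u v ≡ just c) (α ℚ.* ⟦ m ⟧)) ×
  (∀ (v : V n) → IncAtMost v (Colored φ) (α ℚ.* ⟦ m ⟧))

Sparse : ∀ {n} → ℕ → ℚ → ListAssignment n → Set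
Sparse {n} m β L =
  (∀ (u v : V n) → u ≢ v → AtMost {ℕ} (λ c → L u v c ≡ true) (β ℚ.* ⟦ m ⟧)) ×
  (∀ (v : V n) c → IncAtMost v (λ v w → L v w c ≡ true) (β ℚ.* ⟦ m ⟧))

Conflict : ∀ {n} → ListAssignment n → TotalColoring n → V n → V n → Set
Conflict L h u v = L u v (h u v) ≡ true

_==_ : ∀ {n} → V n → V n → Bool
a == b = does (idx a ≟ idx b)

sameEdge : ∀ {n} → V n → V n → V n → V n → Bool
sameEdge x y a b = ((x == a) ∧ (y == b)) ∨ ((x == b) ∧ (y == a))

swap4 : ∀ {n} → TotalColoring n → ℕ → ℕ → V n → V n → V n → V n → TotalColoring n
swap4 h c₁ c₂ u v z t x y =
  if sameEdge x y u v ∨ sameEdge x y z t then c₂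
  else if sameEdge x y v z ∨ sameEdge x y t u then c₁
  else h x y

TwoColored4Cycle : ∀ {n} → TotalColoring n → V n → V n → V n → V n → ℕ → ℕ → Set
TwoColored4Cycle h u v z t c₁ c₂ =
  (u ≢ v) × (u ≢ z) × (u ≢ t) × (v ≢ z) × (v ≢ t) × (z ≢ t) ×
  (h u v ≡ c₁) × (h z t ≡ c₁) × (h v z ≡ c₂) × (h t u ≡ c₂) × (c₁ ≢ c₂)

Allowed4Cycle : ∀ {n} → ℕ → ListAssignment n → TotalColoring n → V n → V n → V n → V n → ℕ → ℕ → Set
Allowed4Cycle m L h u v z t c₁ c₂ =
  IsProperColoring m h' ×
  (¬ Conflict L h' u v) × (¬ Conflict L h' v z) × (¬ Conflict L h' z t) × (¬ Conflict L h' t u)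
  where h' = swap4 h c₁ c₂ u v z t

Strong : ℕ → ℕ → ℕ → Set
Strong n c₁ c₂ =
  (InRange 1 (n / 2) c₁ × ¬ InRange 1 (n / 2) c₂) ⊎
  (¬ InRange 1 (n / 2) c₁ × InRange 1 (n / 2) c₂)

GoodCycle : ∀ {n} → ℕ → ListAssignment n → TotalColoring n → V n → V n → V n → V n → Set
GoodCycle {n} m L h u v z t =
  ∃ λ c₁ → ∃ λ c₂ → TwoColored4Cycle h u v z t c₁ c₂ ×
    Allowed4Cycle m L h u v z t c₁ c₂ × Strong n c₁ c₂

InManyGoodCycles : ∀ {n} → ℕ → ListAssignment n → TotalColoring n → V n → V n → ℚ → Set
InManyGoodCycles {n} m L h u v k =
  AtLeast {V n × V n} (λ { (z , t) → GoodCycle m L h u v z t }) k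

{-# OPTIONS --safe #-}
module Submission where

-- Colour the conflict edges of h left uncoloured by φ greedily, each with a colour that is
-- outside its list, unused at both endpoints, and unsaturated, i.e. given to fewer than f new
-- edges so far. An endpoint sees only φ-edges and conflict edges, so at most αm + c colours are
-- used there, and at most βm colours lie in the list. A saturated colour carries at least f/2
-- new edges (f ≥ 1), and new edges are conflict edges, of which there are at most nc, so at
-- most 2nc/f colours are saturated. The slack hypothesis leaves a free colour at every step.

open import Defs
open import Data.Nat using (ℕ)
open import Data.Rational using (ℚ)
open import Relation.Binary.PropositionalEquality using (_≡_)

module Counting where

  open import Data.Empty using (⊥; ⊥-elim)
  open import Data.List using (List; []; _∷_; length; filter; map; _++_; cartesianProduct)
  open import Data.List.Properties using (length-removeAt′)
  open import Data.List.Membership.Propositional using (_∈_)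
  open import Data.List.Relation.Unary.All as All using (All; []; _∷_)
  open import Data.List.Relation.Unary.Any using (Any; here; there; any?; _─_)
  open import Data.List.Relation.Unary.Unique.Propositional using (Unique; []; _∷_)
  open import Data.List.Membership.Propositional.Properties using (∈-filter⁺)
  open import Data.Nat using (ℕ; suc; _+_; _*_; _≤_; _<_; z≤n; s≤s)
  open import Data.Nat.Properties
  open import Data.Product using (_×_; _,_)
  open import Data.Sum using (_⊎_; inj₁; inj₂)
  open import Relation.Nullary using (Dec; yes; no; ¬_)
  open import Relation.Unary using (Decidable; ∁)
  open import Relation.Binary.PropositionalEquality
  open import Algebra.Properties.CommutativeSemigroup +-commutativeSemigroup using (interchange)

  private variable
    A B : Set

  ∑ : List A → (A → ℕ) → ℕ
  ∑ []       f = 0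
  ∑ (x ∷ xs) f = f x + ∑ xs f

  𝟙 : {P : Set} → Dec P → ℕ
  𝟙 (yes _) = 1
  𝟙 (no _)  = 0

  count : {P : A → Set} → Decidable P → List A → ℕ
  count P? xs = ∑ xs (λ x → 𝟙 (P? x))

  ∑-mono-≤ : {f g : A → ℕ} (xs : List A) → (∀ x → f x ≤ g x) → ∑ xs f ≤ ∑ xs g
  ∑-mono-≤ []       f≤g = z≤n
  ∑-mono-≤ (x ∷ xs) f≤g = +-mono-≤ (f≤g x) (∑-mono-≤ xs f≤g)

  ∑-distrib-+ : (f g : A → ℕ) (xs : List A) → ∑ xs (λ x → f x + g x) ≡ ∑ xs f + ∑ xs g
  ∑-distrib-+ f g []       = refl
  ∑-distrib-+ f g (x ∷ xs) =
    trans (cong (f x + g x +_) (∑-distrib-+ f g xs)) (interchange (f x) (g x) (∑ xs f) (∑ xs g))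

  ∑-zero : (xs : List A) → ∑ xs (λ _ → 0) ≡ 0
  ∑-zero []       = refl
  ∑-zero (_ ∷ xs) = ∑-zero xs

  ∑-swap : (g : A → B → ℕ) (as : List A) (bs : List B) →
           ∑ as (λ a → ∑ bs (g a)) ≡ ∑ bs (λ b → ∑ as (λ a → g a b))
  ∑-swap g []       bs = sym (∑-zero bs)
  ∑-swap g (a ∷ as) bs = begin
    ∑ bs (g a) + ∑ as (λ a → ∑ bs (g a))          ≡⟨ cong (∑ bs (g a) +_) (∑-swap g as bs) ⟩
    ∑ bs (g a) + ∑ bs (λ b → ∑ as (λ a → g a b))  ≡⟨ ∑-distrib-+ (g a) (λ b → ∑ as (λ a → g a b)) bs ⟨
    ∑ bs (λ b → g a b + ∑ as (λ a → g a b))        ∎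
    where open ≡-Reasoning

  ∑-++ : (f : A → ℕ) (xs ys : List A) → ∑ (xs ++ ys) f ≡ ∑ xs f + ∑ ys f
  ∑-++ f []       ys = refl
  ∑-++ f (x ∷ xs) ys = trans (cong (f x +_) (∑-++ f xs ys)) (sym (+-assoc (f x) _ _))

  ∑-map : (f : B → ℕ) (g : A → B) (xs : List A) → ∑ (map g xs) f ≡ ∑ xs (λ x → f (g x))
  ∑-map f g []       = refl
  ∑-map f g (x ∷ xs) = cong (f (g x) +_) (∑-map f g xs)

  ∑-*-distribˡ : (k : ℕ) (g : A → ℕ) (xs : List A) → ∑ xs (λ x → k * g x) ≡ k * ∑ xs g
  ∑-*-distribˡ k g []       = sym (*-zeroʳ k)
  ∑-*-distribˡ k g (x ∷ xs) = trans (cong (k * g x +_) (∑-*-distribˡ k g xs)) (sym (*-distribˡ-+ k (g x) (∑ xs g)))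

  module _ {P Q R : A → Set} (P? : Decidable P) (Q? : Decidable Q) (R? : Decidable R) where

    count-⊎-≤ : (∀ x → P x → Q x ⊎ R x) → (xs : List A) → count P? xs ≤ count Q? xs + count R? xs
    count-⊎-≤ P⇒Q⊎R xs = ≤-trans (∑-mono-≤ xs λ x → 𝟙-⊎ (P⇒Q⊎R x) (P? x) (Q? x) (R? x))
                                   (≤-reflexive (∑-distrib-+ (λ x → 𝟙 (Q? x)) (λ x → 𝟙 (R? x)) xs))
      where
      𝟙-⊎ : {X Y Z : Set} → (X → Y ⊎ Z) → (x? : Dec X) (y? : Dec Y) (z? : Dec Z) → 𝟙 x? ≤ 𝟙 y? + 𝟙 z?
      𝟙-⊎ X⇒Y⊎Z (no _)  _       _       = z≤n
      𝟙-⊎ X⇒Y⊎Z (yes _) (yes _) _       = s≤s z≤n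
      𝟙-⊎ X⇒Y⊎Z (yes _) (no _)  (yes _) = s≤s z≤n
      𝟙-⊎ X⇒Y⊎Z (yes x) (no ¬y) (no ¬z) with X⇒Y⊎Z x
      ... | inj₁ y = ⊥-elim (¬y y)
      ... | inj₂ z = ⊥-elim (¬z z)

    count-disjoint-≤ : (∀ x → P x → Q x → ⊥) → (∀ x → P x → R x) → (∀ x → Q x → R x) →
                       (xs : List A) → count P? xs + count Q? xs ≤ count R? xs
    count-disjoint-≤ P∩Q=∅ P⇒R Q⇒R xs =
      ≤-trans (≤-reflexive (sym (∑-distrib-+ (λ x → 𝟙 (P? x)) (λ x → 𝟙 (Q? x)) xs)))
              (∑-mono-≤ xs λ x → 𝟙-disjoint (P∩Q=∅ x) (P⇒R x) (Q⇒R x) (P? x) (Q? x) (R? x))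
      where
      𝟙-disjoint : {X Y Z : Set} → (X → Y → ⊥) → (X → Z) → (Y → Z) →
                   (x? : Dec X) (y? : Dec Y) (z? : Dec Z) → 𝟙 x? + 𝟙 y? ≤ 𝟙 z?
      𝟙-disjoint X∩Y=∅ X⇒Z Y⇒Z (yes x) (yes y) _       = ⊥-elim (X∩Y=∅ x y)
      𝟙-disjoint X∩Y=∅ X⇒Z Y⇒Z (yes x) (no _)  (yes _) = ≤-refl
      𝟙-disjoint X∩Y=∅ X⇒Z Y⇒Z (yes x) (no _)  (no ¬z) = ⊥-elim (¬z (X⇒Z x))
      𝟙-disjoint X∩Y=∅ X⇒Z Y⇒Z (no _)  (yes _) (yes _) = ≤-refl
      𝟙-disjoint X∩Y=∅ X⇒Z Y⇒Z (no _)  (yes y) (no ¬z) = ⊥-elim (¬z (Y⇒Z y))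
      𝟙-disjoint X∩Y=∅ X⇒Z Y⇒Z (no _)  (no _)  _       = z≤n

  ∈-─ : {x y : A} {ys : List A} (x∈ys : x ∈ ys) → y ∈ ys → y ≢ x → y ∈ (ys ─ x∈ys)
  ∈-─ (here refl)  (here refl)  y≢x = ⊥-elim (y≢x refl)
  ∈-─ (here refl)  (there y∈ys) y≢x = y∈ys
  ∈-─ (there x∈ys) (here refl)  y≢x = here refl
  ∈-─ (there x∈ys) (there y∈ys) y≢x = there (∈-─ x∈ys y∈ys y≢x)

  unique-⊆⇒length≤ : {xs ys : List A} → Unique xs → (∀ {x} → x ∈ xs → x ∈ ys) → length xs ≤ length ys
  unique-⊆⇒length≤ {xs = []} [] xs⊆ys = z≤n
  unique-⊆⇒length≤ {xs = x ∷ xs} {ys} (x∉xs ∷ u) xs⊆ys = begin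
    suc (length xs)        ≤⟨ s≤s (unique-⊆⇒length≤ u xs⊆ys─x) ⟩
    suc (length (ys ─ x∈)) ≡⟨ length-removeAt′ ys _ ⟨
    length ys              ∎
    where
    open ≤-Reasoning
    x∈ = xs⊆ys (here refl)
    xs⊆ys─x : ∀ {y} → y ∈ xs → y ∈ (ys ─ x∈)
    xs⊆ys─x y∈xs = ∈-─ x∈ (xs⊆ys (there y∈xs)) (λ y≡x → All.lookup x∉xs y∈xs (sym y≡x))

  module _ {P : A → Set} (P? : Decidable P) where

    count-≡0 : (xs : List A) → (∀ x → ¬ P x) → count P? xs ≡ 0
    count-≡0 []       ¬P = refl
    count-≡0 (x ∷ xs) ¬P with P? x
    ... | yes p = ⊥-elim (¬P x p)
    ... | no _  = count-≡0 xs ¬P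

    count-≤1 : {xs : List A} → Unique xs → (∀ x y → P x → P y → x ≡ y) → count P? xs ≤ 1
    count-≤1 []                   P-unique = z≤n
    count-≤1 {x ∷ xs} (x∉xs ∷ u) P-unique with P? x
    ... | no _   = count-≤1 u P-unique
    ... | yes px = ≤-reflexive (cong suc (count-≡0-in xs x∉xs))
      where
      count-≡0-in : (ys : List A) → All (x ≢_) ys → count P? ys ≡ 0
      count-≡0-in []       []           = refl
      count-≡0-in (y ∷ ys) (x≢y ∷ x∉ys) with P? y
      ... | yes py = ⊥-elim (x≢y (P-unique x y px py))
      ... | no _   = count-≡0-in ys x∉ys

    count-pos : {xs : List A} {x : A} → x ∈ xs → P x → 1 ≤ count P? xs
    count-pos {y ∷ xs} (here refl) px with P? y
    ... | yes _  = s≤s z≤n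
    ... | no ¬px = ⊥-elim (¬px px)
    count-pos {y ∷ xs} (there x∈xs) px = ≤-trans (count-pos x∈xs px) (m≤n+m _ (𝟙 (P? y)))

    count<length⇒∃¬ : (xs : List A) → count P? xs < length xs → Any (∁ P) xs
    count<length⇒∃¬ []       ()
    count<length⇒∃¬ (x ∷ xs) c<l with P? x
    ... | yes _  = there (count<length⇒∃¬ xs (≤-pred c<l))
    ... | no ¬px = here ¬px

    𝟙-any≤count : (xs : List A) → 𝟙 (any? P? xs) ≤ count P? xs
    𝟙-any≤count []       = z≤n
    𝟙-any≤count (x ∷ xs) with P? x | any? P? xs | 𝟙-any≤count xs
    ... | yes _ | _     | _  = s≤s z≤n
    ... | no _  | yes _ | ih = ih
    ... | no _  | no _  | _  = z≤n

    length-filter≡count : (xs : List A) → length (filter P? xs) ≡ count P? xs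
    length-filter≡count []       = refl
    length-filter≡count (x ∷ xs) with P? x
    ... | yes _ = cong suc (length-filter≡count xs)
    ... | no _  = length-filter≡count xs

    unique-all⇒length≤count : {ys : List A} → Unique ys → All P ys → (xs : List A) → (∀ y → y ∈ xs) →
                              length ys ≤ count P? xs
    unique-all⇒length≤count u all-P xs complete =
      subst (_ ≤_) (length-filter≡count xs)
        (unique-⊆⇒length≤ u λ {y} y∈ys → ∈-filter⁺ P? (complete y) (All.lookup all-P y∈ys))

  module _ {R : A → B → Set} {Q : B → Set} (R? : ∀ a → Decidable (R a)) (Q? : Decidable Q) where

    ∑-count-fibres-≤ : {as : List A} → Unique as → (∀ a b → R a b → Q b) →
                       (∀ a a′ b → R a b → R a′ b → a ≡ a′) →
                       (bs : List B) → ∑ as (λ a → count (R? a) bs) ≤ count Q? bs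
    ∑-count-fibres-≤ {as} u R⇒Q R-functional bs =
      subst (_≤ count Q? bs) (sym (∑-swap (λ a b → 𝟙 (R? a b)) as bs)) (∑-mono-≤ bs fibre≤1)
      where
      fibre≤1 : ∀ b → count (λ a → R? a b) as ≤ 𝟙 (Q? b)
      fibre≤1 b with Q? b
      ... | yes _  = count-≤1 (λ a → R? a b) u (λ a a′ → R-functional a a′ b)
      ... | no ¬qb = ≤-reflexive (count-≡0 (λ a → R? a b) as (λ a rab → ¬qb (R⇒Q a b rab)))

  count-cartesianProduct : {R : A × B → Set} (R? : Decidable R) (as : List A) (bs : List B) →
                           count R? (cartesianProduct as bs) ≡ ∑ as (λ a → count (λ b → R? (a , b)) bs)
  count-cartesianProduct R? []       bs = refl
  count-cartesianProduct R? (a ∷ as) bs =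
    trans (∑-++ (λ x → 𝟙 (R? x)) (map (a ,_) bs) (cartesianProduct as bs))
          (cong₂ _+_ (∑-map (λ x → 𝟙 (R? x)) (a ,_) bs) (count-cartesianProduct R? as bs))

module RationalBounds where

  open Counting
  open import Data.Empty using (⊥-elim)
  open import Data.Integer as ℤ using (+_)
  import Data.Integer.Properties as ℤ
  open import Data.List using (List; []; _∷_; length; filter)
  open import Data.List.Membership.Propositional using (_∈_)
  open import Data.List.Relation.Unary.All as All using ([])
  open import Data.List.Relation.Unary.All.Properties using (all-filter)
  open import Data.List.Relation.Unary.Unique.Propositional using (Unique; [])
  import Data.List.Relation.Unary.Unique.Propositional.Properties as Unique
  open import Data.Nat as ℕ using (ℕ; zero; suc; z≤n; s≤s)
  import Data.Nat.Properties as ℕ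
  import Data.Nat.Coprimality as Coprime
  open import Data.Rational as ℚ using (ℚ; mkℚ; *≤*; 0ℚ; 1ℚ; _+_; _*_; _-_; _÷_; 1/_; _≤_; _≤?_)
  open import Data.Rational.Properties
  open import Data.Rational.Solver using (module +-*-Solver)
  open import Relation.Nullary using (Dec; ¬_; yes; no; ¬?)
  open import Relation.Unary using (Decidable)
  open import Relation.Binary.PropositionalEquality using (_≡_; refl; sym; trans; cong; subst; subst₂)

  -- ⟦ t ⟧ must never be normalised for a neutral t: it computes a gcd by well-founded recursion
  -- with enormous fuel. Hence the explicit implicit arguments of the ⟦⟧-lemmas throughout, and
  -- case splits through Dec arguments instead of `with` on goals mentioning ⟦_⟧.
  ⟦⟧≡mkℚ : ∀ k → ⟦ k ⟧ ≡ mkℚ (+ k) 0 (Coprime.sym (Coprime.1-coprimeTo k))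
  ⟦⟧≡mkℚ k = normalize-coprime (Coprime.sym (Coprime.1-coprimeTo k))

  ⟦⟧-+ : ∀ a b → ⟦ a ℕ.+ b ⟧ ≡ ⟦ a ⟧ + ⟦ b ⟧
  ⟦⟧-+ a b rewrite ⟦⟧≡mkℚ a | ⟦⟧≡mkℚ b | ℕ.*-identityʳ a | ℕ.*-identityʳ b | ℤ.+◃n≡+n a | ℤ.+◃n≡+n b
    = refl

  ⟦⟧-mono-≤ : ∀ {a b} → a ℕ.≤ b → ⟦ a ⟧ ≤ ⟦ b ⟧
  ⟦⟧-mono-≤ {a} {b} a≤b rewrite ⟦⟧≡mkℚ a | ⟦⟧≡mkℚ b =
    *≤* (subst₂ ℤ._≤_ (sym (ℤ.*-identityʳ (+ a))) (sym (ℤ.*-identityʳ (+ b))) (ℤ.+≤+ a≤b))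

  ⟦⟧-cancel-≤ : ∀ {a b} → ⟦ a ⟧ ≤ ⟦ b ⟧ → a ℕ.≤ b
  ⟦⟧-cancel-≤ {a} {b} ⟦a⟧≤⟦b⟧ rewrite ⟦⟧≡mkℚ a | ⟦⟧≡mkℚ b with ⟦a⟧≤⟦b⟧
  ... | *≤* a≤b = ℤ.drop‿+≤+ (subst₂ ℤ._≤_ (ℤ.*-identityʳ (+ a)) (ℤ.*-identityʳ (+ b)) a≤b)

  ⟦⟧-≤-+ : ∀ {a b c B C} → a ℕ.≤ b ℕ.+ c → ⟦ b ⟧ ≤ B → ⟦ c ⟧ ≤ C → ⟦ a ⟧ ≤ B + C
  ⟦⟧-≤-+ {a} {b} {c} a≤b+c ⟦b⟧≤B ⟦c⟧≤C =
    ≤-trans (⟦⟧-mono-≤ a≤b+c) (subst (_≤ _) (sym (⟦⟧-+ b c)) (+-mono-≤ ⟦b⟧≤B ⟦c⟧≤C))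

  half+half : ∀ c → c ÷ ⟦ 2 ⟧ + c ÷ ⟦ 2 ⟧ ≡ c
  half+half c = trans (sym (*-distribˡ-+ c (1/ ⟦ 2 ⟧) (1/ ⟦ 2 ⟧))) (*-identityʳ c)

  c+c≡2c : ∀ c → c + c ≡ ⟦ 2 ⟧ * c
  c+c≡2c = solve 1 (λ c → c :+ c := (con 1ℚ :+ con 1ℚ) :* c) refl
    where open +-*-Solver using (solve; _:+_; _:*_; _:=_; con)

  ÷-*-cancel : ∀ p q .{{_ : ℚ.NonZero q}} → (p ÷ q) * q ≡ p
  ÷-*-cancel p q = trans (*-assoc p (1/ q) q) (trans (cong (p *_) (*-inverseˡ q)) (*-identityʳ p))

  module _ {A : Set} where

    ⟦∑⟧≤length* : ∀ {c} (g : A → ℕ) → (∀ x → ⟦ g x ⟧ ≤ c) → (xs : List A) →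
                  ⟦ ∑ xs g ⟧ ≤ ⟦ length xs ⟧ * c
    ⟦∑⟧≤length* {c} g g≤c []       = ≤-reflexive (sym (*-zeroˡ c))
    ⟦∑⟧≤length* {c} g g≤c (x ∷ xs) =
      subst (⟦ ∑ (x ∷ xs) g ⟧ ≤_) (sym (trans (cong (_* c) (⟦⟧-+ 1 (length xs))) (1+l*c (⟦ length xs ⟧))))
            (⟦⟧-≤-+ {b = g x} {c = ∑ xs g} ℕ.≤-refl (g≤c x) (⟦∑⟧≤length* g g≤c xs))
      where
      1+l*c : ∀ l → (1ℚ + l) * c ≡ c + l * c
      1+l*c l = solve 2 (λ l c → (con 1ℚ :+ l) :* c := c :+ l :* c) refl l c
        where open +-*-Solver using (solve; _:+_; _:*_; _:=_; con)

    ⟦∑⟧*≤ : ∀ {f} (a b : A → ℕ) → (∀ x → ⟦ a x ⟧ * f ≤ ⟦ b x ⟧) → (xs : List A) →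
            ⟦ ∑ xs a ⟧ * f ≤ ⟦ ∑ xs b ⟧
    ⟦∑⟧*≤ {f} a b a≤b []       = ≤-reflexive (*-zeroˡ f)
    ⟦∑⟧*≤ {f} a b a≤b (x ∷ xs) = begin
      ⟦ a x ℕ.+ ∑ xs a ⟧ * f         ≡⟨ cong (_* f) (⟦⟧-+ (a x) (∑ xs a)) ⟩
      (⟦ a x ⟧ + ⟦ ∑ xs a ⟧) * f     ≡⟨ *-distribʳ-+ f ⟦ a x ⟧ ⟦ ∑ xs a ⟧ ⟩
      ⟦ a x ⟧ * f + ⟦ ∑ xs a ⟧ * f   ≤⟨ +-mono-≤ (a≤b x) (⟦∑⟧*≤ a b a≤b xs) ⟩
      ⟦ b x ⟧ + ⟦ ∑ xs b ⟧           ≡⟨ ⟦⟧-+ (b x) (∑ xs b) ⟨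
      ⟦ b x ℕ.+ ∑ xs b ⟧             ∎
      where open ≤-Reasoning

    module _ {P : A → Set} {b : ℚ} (P? : Decidable P) where

      AtMost⇒count≤ : {xs : List A} → Unique xs → AtMost P b → ⟦ count P? xs ⟧ ≤ b
      AtMost⇒count≤ {xs} u atMost = subst (λ k → ⟦ k ⟧ ≤ b) (length-filter≡count P? xs)
        (atMost (filter P? xs) (Unique.filter⁺ P? u) (all-filter P? xs))

      count≤⇒AtMost : {xs : List A} → (∀ x → x ∈ xs) → ⟦ count P? xs ⟧ ≤ b → AtMost P b
      count≤⇒AtMost {xs} complete count≤b ys u all-P =
        ≤-trans (⟦⟧-mono-≤ (unique-all⇒length≤count P? u all-P xs complete)) count≤b

    AtMost-anti : ∀ {P Q : A → Set} {b} → (∀ x → Q x → P x) → AtMost P b → AtMost Q b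
    AtMost-anti Q⇒P atMost xs u all-Q = atMost xs u (All.map (λ {x} → Q⇒P x) all-Q)

    AtMost-nonNeg : ∀ {P : A → Set} {b} → AtMost P b → 0ℚ ≤ b
    AtMost-nonNeg atMost = atMost [] [] []

  module _ {f : ℚ} (1≤f : 1ℚ ≤ f) where

    saturated-≤ : ∀ ν → ¬ (⟦ suc ν ⟧ ≤ f) → f ≤ ⟦ 2 ℕ.* ν ⟧
    saturated-≤ zero    ¬1≤f = ⊥-elim (¬1≤f 1≤f)
    saturated-≤ (suc j) ¬ν≤f = <⇒≤ (<-≤-trans (≰⇒> ¬ν≤f) (⟦⟧-mono-≤ 2+j≤2[1+j]))
      where
      2+j≤2[1+j] : suc (suc j) ℕ.≤ 2 ℕ.* suc j
      2+j≤2[1+j] = subst (ℕ._≤ 2 ℕ.* suc j) (ℕ.+-comm (suc j) 1) (ℕ.+-monoʳ-≤ (suc j) (s≤s z≤n))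

    count-saturated : ∀ {B : Set} (g : B → ℕ) (ks : List B) →
                      ⟦ count (λ k → ¬? (⟦ suc (g k) ⟧ ≤? f)) ks ⟧ * f ≤ ⟦ 2 ℕ.* ∑ ks g ⟧
    count-saturated g ks =
      subst (λ t → ⟦ count sat? ks ⟧ * f ≤ ⟦ t ⟧) (∑-*-distribˡ 2 g ks)
            (⟦∑⟧*≤ (λ k → 𝟙 (sat? k)) (λ k → 2 ℕ.* g k) 𝟙-saturated ks)
      where
      sat? : Decidable (λ k → ¬ (⟦ suc (g k) ⟧ ≤ f))
      sat? k = ¬? (⟦ suc (g k) ⟧ ≤? f)
      𝟙-saturated : ∀ k → ⟦ 𝟙 (sat? k) ⟧ * f ≤ ⟦ 2 ℕ.* g k ⟧
      𝟙-saturated k = 𝟙-¬? (g k) (⟦ suc (g k) ⟧ ≤? f)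
        where
        𝟙-¬? : ∀ ν (ν<f? : Dec (⟦ suc ν ⟧ ≤ f)) → ⟦ 𝟙 (¬? ν<f?) ⟧ * f ≤ ⟦ 2 ℕ.* ν ⟧
        𝟙-¬? ν (yes _)    = subst (_≤ ⟦ 2 ℕ.* ν ⟧) (sym (*-zeroˡ f)) (⟦⟧-mono-≤ {0} {2 ℕ.* ν} z≤n)
        𝟙-¬? ν (no ¬ν<f) = subst (_≤ ⟦ 2 ℕ.* ν ⟧) (sym (*-identityˡ f)) (saturated-≤ ν ¬ν<f)

  budget : ∀ {M β α C D a x y s} → a ≤ β * M → x ≤ α * M + C → y ≤ α * M + C → s ≤ D →
           1ℚ ≤ (((M - β * M) - ⟦ 2 ⟧ * α * M) - ⟦ 2 ⟧ * C) - D → (a + x) + (y + s) + 1ℚ ≤ M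
  budget {M} {β} {α} {C} {D} a≤ x≤ y≤ s≤ 1≤slack = begin
    _                                                          ≤⟨ +-mono-≤ (+-mono-≤ (+-mono-≤ a≤ x≤) (+-mono-≤ y≤ s≤)) 1≤slack ⟩
    (β * M + (α * M + C)) + ((α * M + C) + D) + slack             ≡⟨ solve 5 (λ M β α C D →
        (β :* M :+ (α :* M :+ C)) :+ ((α :* M :+ C) :+ D)
          :+ ((((M :- β :* M) :- (con 1ℚ :+ con 1ℚ) :* α :* M) :- (con 1ℚ :+ con 1ℚ) :* C) :- D) := M)
        refl M β α C D ⟩
    M                                                          ∎
    where
    open ≤-Reasoning
    open +-*-Solver using (solve; _:+_; _:*_; _:-_; _:=_; con)
    slack = (((M - β * M) - ⟦ 2 ⟧ * α * M) - ⟦ 2 ⟧ * C) - D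

  one≤weight : ∀ {f M D} → 0ℚ ≤ f → 1ℚ ≤ M → D + 1ℚ ≤ M → M ≤ D * f → 1ℚ ≤ f
  one≤weight {f} {M} {D} 0≤f 1≤M D+1≤M M≤Df with 1ℚ ≤? f
  ... | yes 1≤f = 1≤f
  ... | no ¬1≤f = ⊥-elim (<-irrefl refl (begin-strict
    M              ≤⟨ M≤Df ⟩
    D * f          ≤⟨ *-monoʳ-≤-nonNeg f {{ℚ.nonNegative 0≤f}} D≤M-1 ⟩
    (M - 1ℚ) * f   ≤⟨ *-monoˡ-≤-nonNeg (M - 1ℚ) {{ℚ.nonNegative 0≤M-1}} (<⇒≤ (≰⇒> ¬1≤f)) ⟩
    (M - 1ℚ) * 1ℚ  ≡⟨ *-identityʳ (M - 1ℚ) ⟩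
    M - 1ℚ         <⟨ +-monoʳ-< M (negative⁻¹ (ℚ.- 1ℚ)) ⟩
    M + 0ℚ         ≡⟨ +-identityʳ M ⟩
    M              ∎))
    where
    open ≤-Reasoning
    open +-*-Solver using (solve; _:+_; _:-_; _:=_; con)
    -1-cancel : ∀ {p q} → p + 1ℚ ≤ q → p ≤ q - 1ℚ
    -1-cancel {p} {q} p+1≤q = subst (_≤ q - 1ℚ) (solve 1 (λ p → p :+ con 1ℚ :- con 1ℚ := p) refl p)
                                    (+-monoˡ-≤ (ℚ.- 1ℚ) p+1≤q)
    D≤M-1 : D ≤ M - 1ℚ
    D≤M-1 = -1-cancel D+1≤M
    0≤M-1 : 0ℚ ≤ M - 1ℚ
    0≤M-1 = -1-cancel (subst (_≤ M) (sym (+-identityˡ 1ℚ)) 1≤M)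

module VertexSet (n : ℕ) where

  open Counting
  open RationalBounds
  open import Data.Fin as Fin using (Fin; toℕ)
  import Data.Fin.Properties as Fin
  open import Data.List using (List; map; allFin; cartesianProduct; length)
  import Data.List.Properties as List
  open import Data.List.Membership.Propositional using (_∈_)
  open import Data.List.Membership.Propositional.Properties using (∈-map⁺; ∈-allFin; ∈-cartesianProduct⁺)
  open import Data.List.Relation.Unary.Unique.Propositional using (Unique)
  import Data.List.Relation.Unary.Unique.Propositional.Properties as Unique
  open import Data.Nat as ℕ using (ℕ; _+_; _*_; _<_; _≤_; _<?_)
  import Data.Nat.Properties as ℕ
  open import Data.Product using (_×_; _,_)
  open import Data.Rational as ℚ using (ℚ)
  open import Data.Sum using (_⊎_; inj₁; inj₂)
  open import Relation.Binary using (DecidableEquality; tri<; tri≈; tri>)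
  open import Relation.Nullary using (Dec; ¬_; ¬?; contradiction)
  open import Relation.Nullary.Decidable using (map′; _×-dec_)
  open import Relation.Unary using (Decidable)
  open import Relation.Binary.PropositionalEquality

  vertices : List (V n)
  vertices = map vtx (allFin (n + n))

  vertices-unique : Unique vertices
  vertices-unique = Unique.map⁺ (cong idx) (Unique.allFin⁺ (n + n))

  ∈-vertices : ∀ v → v ∈ vertices
  ∈-vertices v = ∈-map⁺ vtx (∈-allFin (idx v))

  length-vertices : length vertices ≡ 2 * n
  length-vertices = begin
    length vertices                   ≡⟨ List.length-map (vtx {n}) (allFin (n + n)) ⟩
    length (allFin (n + n))           ≡⟨ List.length-tabulate {n = n + n} (λ (i : Fin (n + n)) → i) ⟩
    n + n                             ≡⟨ cong (n +_) (ℕ.+-identityʳ n) ⟨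
    2 * n                             ∎
    where open ≡-Reasoning

  pairs : List (V n × V n)
  pairs = cartesianProduct vertices vertices

  pairs-unique : Unique pairs
  pairs-unique = Unique.cartesianProduct⁺ vertices-unique vertices-unique

  ∈-pairs : ∀ e → e ∈ pairs
  ∈-pairs (u , v) = ∈-cartesianProduct⁺ (∈-vertices u) (∈-vertices v)

  _≟ᵥ_ : DecidableEquality (V n)
  vtx i ≟ᵥ vtx j = map′ (cong vtx) (cong idx) (i Fin.≟ j)

  _<ᵥ_ : V n → V n → Set
  u <ᵥ v = toℕ (idx u) < toℕ (idx v)

  <ᵥ⇒≢ : ∀ {u v} → u <ᵥ v → u ≢ v
  <ᵥ⇒≢ u<v refl = ℕ.<-irrefl refl u<v

  <ᵥ-asym : ∀ {u v} → u <ᵥ v → ¬ v <ᵥ u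
  <ᵥ-asym = ℕ.<-asym

  ≢⇒<ᵥ⊎>ᵥ : ∀ {u v} → u ≢ v → u <ᵥ v ⊎ v <ᵥ u
  ≢⇒<ᵥ⊎>ᵥ {u} {v} u≢v with ℕ.<-cmp (toℕ (idx u)) (toℕ (idx v))
  ... | tri< u<v _ _ = inj₁ u<v
  ... | tri≈ _ u≡v _ = contradiction (cong vtx (Fin.toℕ-injective u≡v)) u≢v
  ... | tri> _ _ v<u = inj₂ v<u

  Edge : (V n → V n → Set) → V n × V n → Set
  Edge Q (u , v) = u <ᵥ v × Q u v

  Incident : (V n → V n → Set) → V n → V n → Set
  Incident Q v w = w ≢ v × Q v w

  module _ {Q : V n → V n → Set} (Q? : ∀ u v → Dec (Q u v)) where

    edge? : Decidable (Edge Q)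
    edge? (u , v) = (toℕ (idx u) <? toℕ (idx v)) ×-dec Q? u v

    incident? : ∀ v → Decidable (Incident Q v)
    incident? v w = ¬? (w ≟ᵥ v) ×-dec Q? v w

    edgeCount : ℕ
    edgeCount = count edge? pairs

    degree : V n → ℕ
    degree v = count (incident? v) vertices

    module _ {b : ℚ} where

      EdgeAtMost⇒edgeCount≤ : EdgeAtMost Q b → ⟦ edgeCount ⟧ ℚ.≤ b
      EdgeAtMost⇒edgeCount≤ atMost = AtMost⇒count≤ edge? pairs-unique (AtMost-anti (λ { (u , v) e → e }) atMost)

      edgeCount≤⇒EdgeAtMost : ⟦ edgeCount ⟧ ℚ.≤ b → EdgeAtMost Q b
      edgeCount≤⇒EdgeAtMost count≤b = AtMost-anti (λ { (u , v) e → e }) (count≤⇒AtMost edge? ∈-pairs count≤b)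

      IncAtMost⇒degree≤ : ∀ v → IncAtMost v Q b → ⟦ degree v ⟧ ℚ.≤ b
      IncAtMost⇒degree≤ v = AtMost⇒count≤ (incident? v) vertices-unique

      degree≤⇒IncAtMost : ∀ v → ⟦ degree v ⟧ ℚ.≤ b → IncAtMost v Q b
      degree≤⇒IncAtMost v = count≤⇒AtMost (incident? v) ∈-vertices

    handshake : (∀ u v → Q u v → Q v u) → 2 * edgeCount ≤ ∑ vertices degree
    handshake Q-sym = begin
      2 * edgeCount                                  ≡⟨ cong (2 *_) (count-cartesianProduct edge? vertices vertices) ⟩
      2 * ∑ vertices forward                         ≡⟨ cong (∑ vertices forward +_) (ℕ.+-identityʳ _) ⟩
      ∑ vertices forward + ∑ vertices forward        ≡⟨ cong (∑ vertices forward +_) ∑forward≡∑backward ⟩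
      ∑ vertices forward + ∑ vertices backward       ≡⟨ ∑-distrib-+ forward backward vertices ⟨
      ∑ vertices (λ u → forward u + backward u)      ≤⟨ ∑-mono-≤ vertices split ⟩
      ∑ vertices degree                              ∎
      where
      open ℕ.≤-Reasoning
      forward backward : V n → ℕ
      forward u = count (λ v → edge? (u , v)) vertices
      backward u = count (λ v → edge? (v , u)) vertices
      ∑forward≡∑backward : ∑ vertices forward ≡ ∑ vertices backward
      ∑forward≡∑backward = ∑-swap (λ u v → 𝟙 (edge? (u , v))) vertices vertices
      split : ∀ u → forward u + backward u ≤ degree u
      split u = count-disjoint-≤ (λ v → edge? (u , v)) (λ v → edge? (v , u)) (incident? u)
        (λ { v (u<v , _) (v<u , _) → <ᵥ-asym u<v v<u })
        (λ { v (u<v , q) → (λ v≡u → <ᵥ⇒≢ u<v (sym v≡u)) , q })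
        (λ { v (v<u , q) → <ᵥ⇒≢ v<u , Q-sym v u q })
        vertices

module FirstFit (n m : ℕ) (f : ℚ) (φ : PartialColoring n) (L : ListAssignment n) (h : TotalColoring n)
              (L-sym : ∀ u v c → L u v c ≡ L v u c) (h-sym : ∀ u v → h u v ≡ h v u) where

  open Counting
  open RationalBounds
  open import Data.Bool as Bool using (true; false)
  open import Data.Bool.Properties using (¬-not)
  open import Data.Empty using (⊥; ⊥-elim)
  open import Data.List using (List; []; _∷_; applyUpTo; length; foldl)
  open import Data.List.Properties using (length-applyUpTo)
  open import Data.List.Membership.Propositional using (_∈_; find; lose)
  open import Data.List.Membership.Propositional.Properties using (∈-applyUpTo⁻)
  open import Data.List.Relation.Unary.All as All using (All; []; _∷_)
  open import Data.List.Relation.Unary.Any using (Any; any?)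
  open import Data.List.Relation.Unary.Unique.Propositional using (Unique)
  import Data.List.Relation.Unary.Unique.Propositional.Properties as Unique
  open import Data.Maybe using (Maybe; just; nothing)
  open import Data.Maybe.Properties using (just-injective) renaming (≡-dec to ≡-decₘ)
  open import Data.Nat as ℕ using (ℕ; suc; _+_; _≤_; s≤s; z≤n)
  import Data.Nat.Properties as ℕ
  open import Data.Product using (_×_; _,_; proj₁; proj₂)
  open import Data.Rational as ℚ using (ℚ; 0ℚ; _≤?_) renaming (_≤_ to _≤ℚ_)
  import Data.Rational.Properties as ℚ
  open import Data.Sum using (_⊎_; inj₁; inj₂)
  open import Function using (_∘′_)
  open import Relation.Nullary using (Dec; yes; no; ¬_; ¬?; contradiction)
  open import Relation.Nullary.Decidable using (_×-dec_; _⊎-dec_; decidable-stable)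
  open import Relation.Unary using (Decidable; ∁)
  open import Relation.Binary.PropositionalEquality

  open VertexSet n

  colours : List ℕ
  colours = applyUpTo suc m

  colours-unique : Unique colours
  colours-unique = Unique.applyUpTo⁺₁ suc m (λ i<j _ → ℕ.<⇒≢ i<j ∘′ ℕ.suc-injective)

  ∈-colours⇒InRange : ∀ {k} → k ∈ colours → InRange 1 m k
  ∈-colours⇒InRange k∈ with ∈-applyUpTo⁻ suc k∈
  ... | i , i<m , refl = s≤s z≤n , i<m

  length-colours : length colours ≡ m
  length-colours = length-applyUpTo suc m

  _≟ₘ_ : (a b : Maybe ℕ) → Dec (a ≡ b)
  _≟ₘ_ = ≡-decₘ ℕ._≟_

  conflict? : ∀ u v → Dec (Conflict L h u v)
  conflict? u v = L u v (h u v) Bool.≟ true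

  Conflict-sym : ∀ u v → Conflict L h u v → Conflict L h v u
  Conflict-sym u v c = trans (cong (L v u) (h-sym v u)) (trans (sym (L-sym u v (h u v))) c)

  colored? : (ψ : PartialColoring n) → ∀ u v → Dec (Colored ψ u v)
  colored? ψ u v with ψ u v
  ... | just c  = yes (c , refl)
  ... | nothing = no λ { (_ , ()) }

  NewEdge : PartialColoring n → ℕ → V n → V n → Set
  NewEdge ψ k u v = φ u v ≡ nothing × ψ u v ≡ just k

  newEdge? : (ψ : PartialColoring n) (k : ℕ) → ∀ u v → Dec (NewEdge ψ k u v)
  newEdge? ψ k u v = (φ u v ≟ₘ nothing) ×-dec (ψ u v ≟ₘ just k)

  newCount : PartialColoring n → ℕ → ℕ
  newCount ψ k = edgeCount (newEdge? ψ k)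

  UsedAt : PartialColoring n → V n → ℕ → Set
  UsedAt ψ x k = Any (Incident (λ u v → ψ u v ≡ just k) x) vertices

  Saturated : PartialColoring n → ℕ → Set
  Saturated ψ k = ¬ (⟦ suc (newCount ψ k) ⟧ ≤ℚ f)

  Forbidden : PartialColoring n → V n → V n → ℕ → Set
  Forbidden ψ x y k = (L x y k ≡ true ⊎ UsedAt ψ x k) ⊎ (UsedAt ψ y k ⊎ Saturated ψ k)

  usedAt? : (ψ : PartialColoring n) (x : V n) → Decidable (UsedAt ψ x)
  usedAt? ψ x k = any? (incident? (λ u v → ψ u v ≟ₘ just k) x) vertices

  saturated? : (ψ : PartialColoring n) → Decidable (Saturated ψ)
  saturated? ψ k = ¬? (⟦ suc (newCount ψ k) ⟧ ≤? f)

  forbidden? : (ψ : PartialColoring n) (x y : V n) → Decidable (Forbidden ψ x y)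
  forbidden? ψ x y k = ((L x y k Bool.≟ true) ⊎-dec usedAt? ψ x k) ⊎-dec (usedAt? ψ y k ⊎-dec saturated? ψ k)

  SameEdge : V n → V n → V n → V n → Set
  SameEdge x y u v = (u ≡ x × v ≡ y) ⊎ (u ≡ y × v ≡ x)

  sameEdge? : ∀ x y u v → Dec (SameEdge x y u v)
  sameEdge? x y u v = ((u ≟ᵥ x) ×-dec (v ≟ᵥ y)) ⊎-dec ((u ≟ᵥ y) ×-dec (v ≟ᵥ x))

  SameEdge-sym : ∀ {x y u v} → SameEdge x y u v → SameEdge x y v u
  SameEdge-sym (inj₁ (u≡x , v≡y)) = inj₂ (v≡y , u≡x)
  SameEdge-sym (inj₂ (u≡y , v≡x)) = inj₁ (v≡x , u≡y)

  extend : PartialColoring n → V n → V n → ℕ → PartialColoring n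
  extend ψ x y k u v with ψ u v | sameEdge? x y u v
  ... | just j  | _     = just j
  ... | nothing | yes _ = just k
  ... | nothing | no _  = nothing

  module _ (ψ : PartialColoring n) (x y : V n) (k : ℕ) where

    extend-old : ∀ {u v j} → ψ u v ≡ just j → extend ψ x y k u v ≡ just j
    extend-old {u} {v} ψuv≡j with ψ u v
    ... | just _ = ψuv≡j

    extend-new : ψ x y ≡ nothing → extend ψ x y k x y ≡ just k
    extend-new ψxy≡∅ with ψ x y | sameEdge? x y x y
    ... | nothing | yes _ = refl
    ... | nothing | no ¬same = contradiction (inj₁ (refl , refl)) ¬same

    extend-cases : ∀ {u v j} → extend ψ x y k u v ≡ just j →
                   ψ u v ≡ just j ⊎ (ψ u v ≡ nothing × j ≡ k × SameEdge x y u v)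
    extend-cases {u} {v} eq with ψ u v | sameEdge? x y u v
    ... | just _  | _         = inj₁ eq
    ... | nothing | yes same  = inj₂ (refl , sym (just-injective eq) , same)

    extend-sym : (∀ u v → ψ u v ≡ ψ v u) → ∀ u v → extend ψ x y k u v ≡ extend ψ x y k v u
    extend-sym ψ-sym u v rewrite ψ-sym u v with ψ v u | sameEdge? x y u v | sameEdge? x y v u
    ... | just _  | _        | _        = refl
    ... | nothing | yes _    | yes _    = refl
    ... | nothing | no _     | no _     = refl
    ... | nothing | yes same | no ¬same = contradiction (SameEdge-sym same) ¬same
    ... | nothing | no ¬same | yes same = contradiction (SameEdge-sym same) ¬same

  record Valid (ψ : PartialColoring n) : Set where
    field
      symmetric : ∀ u v → ψ u v ≡ ψ v u
      extends   : ∀ u v k → φ u v ≡ just k → ψ u v ≡ just k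
      new-edge  : ∀ u v k → NewEdge ψ k u v → u ≢ v × Conflict L h u v × L u v k ≡ false × InRange 1 m k
      proper    : ∀ u v w c → u ≢ v → u ≢ w → v ≢ w → ψ u v ≡ just c → ψ u w ≡ just c → ⊥
      light     : ∀ k → ⟦ newCount ψ k ⟧ ≤ℚ f

  module Extension {ψ : PartialColoring n} (valid : Valid ψ) {x y : V n} (x<y : x <ᵥ y)
                   (conflict : Conflict L h x y) {k : ℕ} (k∈ : k ∈ colours) (allowed : ¬ Forbidden ψ x y k) where

    open Valid valid

    ψ⁺ : PartialColoring n
    ψ⁺ = extend ψ x y k

    x≢y : x ≢ y
    x≢y = <ᵥ⇒≢ x<y

    L-free : L x y k ≡ false
    L-free = ¬-not (λ Lxyk → allowed (inj₁ (inj₁ Lxyk)))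

    unused : ∀ {u w} → u ≡ x ⊎ u ≡ y → w ≢ u → ψ u w ≢ just k
    unused (inj₁ refl) w≢x ψxw = allowed (inj₁ (inj₂ (lose (∈-vertices _) (w≢x , ψxw))))
    unused (inj₂ refl) w≢y ψyw = allowed (inj₂ (inj₁ (lose (∈-vertices _) (w≢y , ψyw))))

    unsaturated : ⟦ suc (newCount ψ k) ⟧ ≤ℚ f
    unsaturated = decidable-stable (⟦ suc (newCount ψ k) ⟧ ≤? f) (λ sat → allowed (inj₂ (inj₂ sat)))

    endpoint : ∀ {u v} → SameEdge x y u v → u ≡ x ⊎ u ≡ y
    endpoint (inj₁ (u≡x , _)) = inj₁ u≡x
    endpoint (inj₂ (u≡y , _)) = inj₂ u≡y

    same-partner : ∀ {u v w} → SameEdge x y u v → SameEdge x y u w → v ≡ w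
    same-partner (inj₁ (_ , refl))    (inj₁ (_ , refl))    = refl
    same-partner (inj₂ (_ , refl))    (inj₂ (_ , refl))    = refl
    same-partner (inj₁ (refl , _))    (inj₂ (u≡y , _))     = contradiction u≡y x≢y
    same-partner (inj₂ (refl , _))    (inj₁ (u≡x , _))     = contradiction (sym u≡x) x≢y

    new-edge⁺ : ∀ u v j → NewEdge ψ⁺ j u v → u ≢ v × Conflict L h u v × L u v j ≡ false × InRange 1 m j
    new-edge⁺ u v j (φ∅ , ψ⁺uv) with extend-cases ψ x y k ψ⁺uv
    ... | inj₁ ψuv                             = new-edge u v j (φ∅ , ψuv)
    ... | inj₂ (_ , refl , inj₁ (refl , refl)) = x≢y , conflict , L-free , ∈-colours⇒InRange k∈
    ... | inj₂ (_ , refl , inj₂ (refl , refl)) =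
      (λ y≡x → x≢y (sym y≡x)) , Conflict-sym x y conflict , trans (L-sym y x k) L-free , ∈-colours⇒InRange k∈

    proper⁺ : ∀ u v w c → u ≢ v → u ≢ w → v ≢ w → ψ⁺ u v ≡ just c → ψ⁺ u w ≡ just c → ⊥
    proper⁺ u v w c u≢v u≢w v≢w ψ⁺uv ψ⁺uw with extend-cases ψ x y k ψ⁺uv | extend-cases ψ x y k ψ⁺uw
    ... | inj₁ ψuv              | inj₁ ψuw              = proper u v w c u≢v u≢w v≢w ψuv ψuw
    ... | inj₂ (_ , refl , uv)  | inj₁ ψuw              = unused (endpoint uv) (λ w≡u → u≢w (sym w≡u)) ψuw
    ... | inj₁ ψuv              | inj₂ (_ , refl , uw)  = unused (endpoint uw) (λ v≡u → u≢v (sym v≡u)) ψuv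
    ... | inj₂ (_ , _ , uv)     | inj₂ (_ , _ , uw)     = v≢w (same-partner uv uw)

    Pinned : ℕ → V n × V n → Set
    Pinned k′ (u , v) = u ≡ x × v ≡ y × k′ ≡ k

    pinned? : ∀ k′ → Decidable (Pinned k′)
    pinned? k′ (u , v) = (u ≟ᵥ x) ×-dec ((v ≟ᵥ y) ×-dec (k′ ℕ.≟ k))

    newCount-extend : ∀ k′ → newCount ψ⁺ k′ ≤ newCount ψ k′ + count (pinned? k′) pairs
    newCount-extend k′ = count-⊎-≤ (edge? (newEdge? ψ⁺ k′)) (edge? (newEdge? ψ k′)) (pinned? k′) new-or-pinned pairs
      where
      new-or-pinned : ∀ e → Edge (NewEdge ψ⁺ k′) e → Edge (NewEdge ψ k′) e ⊎ Pinned k′ e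
      new-or-pinned (u , v) (u<v , φ∅ , ψ⁺uv) with extend-cases ψ x y k ψ⁺uv
      ... | inj₁ ψuv                             = inj₁ (u<v , φ∅ , ψuv)
      ... | inj₂ (_ , k′≡k , inj₁ (u≡x , v≡y))   = inj₂ (u≡x , v≡y , k′≡k)
      ... | inj₂ (_ , _ , inj₂ (refl , refl))    = ⊥-elim (<ᵥ-asym x<y u<v)

    newCount⁺-at-k : newCount ψ⁺ k ≤ suc (newCount ψ k)
    newCount⁺-at-k = ℕ.≤-trans (newCount-extend k)
                       (ℕ.≤-trans (ℕ.+-monoʳ-≤ (newCount ψ k) pinned≤1) (ℕ.≤-reflexive (ℕ.+-comm (newCount ψ k) 1)))
      where
      pinned≤1 : count (pinned? k) pairs ≤ 1
      pinned≤1 = count-≤1 (pinned? k) pairs-unique λ { _ _ (refl , refl , _) (refl , refl , _) → refl }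

    newCount⁺-elsewhere : ∀ {k′} → k′ ≢ k → newCount ψ⁺ k′ ≤ newCount ψ k′
    newCount⁺-elsewhere {k′} k′≢k = ℕ.≤-trans (newCount-extend k′)
                                      (ℕ.≤-reflexive (trans (cong (newCount ψ k′ +_) pinned≡0) (ℕ.+-identityʳ (newCount ψ k′))))
      where
      pinned≡0 : count (pinned? k′) pairs ≡ 0
      pinned≡0 = count-≡0 (pinned? k′) pairs λ { _ (_ , _ , k′≡k) → k′≢k k′≡k }

    light⁺ : ∀ k′ → ⟦ newCount ψ⁺ k′ ⟧ ≤ℚ f
    light⁺ k′ = by-cases (k′ ℕ.≟ k)
      where
      by-cases : Dec (k′ ≡ k) → ⟦ newCount ψ⁺ k′ ⟧ ≤ℚ f
      by-cases (yes k′≡k) = subst (λ j → ⟦ newCount ψ⁺ j ⟧ ≤ℚ f) (sym k′≡k)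
        (ℚ.≤-trans {⟦ newCount ψ⁺ k ⟧} {⟦ suc (newCount ψ k) ⟧} {f} (⟦⟧-mono-≤ newCount⁺-at-k) unsaturated)
      by-cases (no k′≢k)  =
        ℚ.≤-trans {⟦ newCount ψ⁺ k′ ⟧} {⟦ newCount ψ k′ ⟧} {f} (⟦⟧-mono-≤ (newCount⁺-elsewhere k′≢k)) (light k′)

    valid⁺ : Valid ψ⁺
    valid⁺ = record
      { symmetric = extend-sym ψ x y k symmetric
      ; extends   = λ u v j φuv → extend-old ψ x y k (extends u v j φuv)
      ; new-edge  = new-edge⁺
      ; proper    = proper⁺
      ; light     = light⁺
      }

  Free : PartialColoring n → V n → V n → ℕ → Set
  Free ψ x y = ∁ (Forbidden ψ x y)

  colourWith : (ψ : PartialColoring n) (x y : V n) → Maybe ℕ → Dec (Any (Free ψ x y) colours) → PartialColoring n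
  colourWith ψ x y nothing (yes free) = extend ψ x y (proj₁ (find free))
  colourWith ψ x y _       _          = ψ

  step : PartialColoring n → V n × V n → PartialColoring n
  step ψ (x , y) = colourWith ψ x y (ψ x y) (any? (λ k → ¬? (forbidden? ψ x y k)) colours)

  step-elim : (P : PartialColoring n → Set) (ψ : PartialColoring n) (x y : V n) →
              (ψ x y ≡ nothing → (free : Any (Free ψ x y) colours) → P (extend ψ x y (proj₁ (find free)))) →
              (ψ x y ≡ nothing → ¬ Any (Free ψ x y) colours → P ψ) →
              (∀ j → ψ x y ≡ just j → P ψ) →
              P (step ψ (x , y))
  step-elim P ψ x y new stuck old = go (ψ x y) refl (any? (λ k → ¬? (forbidden? ψ x y k)) colours)
    where
    go : ∀ c → ψ x y ≡ c → (free? : Dec (Any (Free ψ x y) colours)) → P (colourWith ψ x y c free?)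
    go nothing  ψxy≡∅ (yes free)   = new ψxy≡∅ free
    go nothing  ψxy≡∅ (no no-free) = stuck ψxy≡∅ no-free
    go (just j) ψxy≡j _            = old j ψxy≡j

  step-mono : ∀ ψ e {u v} → Colored ψ u v → Colored (step ψ e) u v
  step-mono ψ (x , y) {u} {v} (c , ψuv) = step-elim (λ ψ′ → Colored ψ′ u v) ψ x y
    (λ _ _ → c , extend-old ψ x y _ ψuv) (λ _ _ → c , ψuv) (λ _ _ → c , ψuv)

  Covered : PartialColoring n → V n × V n → Set
  Covered ψ (u , v) = Colored ψ u v

  run-mono : ∀ {ψ} (es : List (V n × V n)) {e} → Covered ψ e → Covered (foldl step ψ es) e
  run-mono           []       c = c
  run-mono {ψ} (e′ ∷ es) {u , v} c = run-mono es (step-mono ψ e′ {u} {v} c)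

  NeverStuck : Set
  NeverStuck = ∀ {ψ} → Valid ψ → ∀ {x y} → x <ᵥ y → Conflict L h x y → ψ x y ≡ nothing →
               Any (Free ψ x y) colours

  module _ (never-stuck : NeverStuck) where

    step-valid : ∀ {ψ} → Valid ψ → ∀ {x y} → x <ᵥ y → Conflict L h x y →
                 Valid (step ψ (x , y)) × Colored (step ψ (x , y)) x y
    step-valid {ψ} valid {x} {y} x<y conflict = step-elim (λ ψ′ → Valid ψ′ × Colored ψ′ x y) ψ x y
      (λ ψxy≡∅ free → let (k , k∈ , allowed) = find free in
                      Extension.valid⁺ valid x<y conflict k∈ allowed , k , extend-new ψ x y k ψxy≡∅)
      (λ ψxy≡∅ no-free → contradiction (never-stuck valid x<y conflict ψxy≡∅) no-free)
      (λ j ψxy≡j → valid , j , ψxy≡j)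

    run-valid : ∀ {ψ} → Valid ψ → (es : List (V n × V n)) → All (Edge (Conflict L h)) es →
                Valid (foldl step ψ es) × All (Covered (foldl step ψ es)) es
    run-valid valid []              []                      = valid , []
    run-valid valid ((x , y) ∷ es) ((x<y , conflict) ∷ conflicts) =
      let (valid′ , xy-coloured) = step-valid valid x<y conflict
          (valid″ , covered)     = run-valid valid′ es conflicts
      in valid″ , run-mono es xy-coloured ∷ covered

  φ-valid : IsPrecoloring m φ → 0ℚ ≤ℚ f → Valid φ
  φ-valid (φ-sym , _ , φ-proper) 0≤f = record
    { symmetric = φ-sym
    ; extends   = λ _ _ _ φuv → φuv
    ; new-edge  = λ { _ _ _ (φ∅ , φuv) → ⊥-elim (nothing≢just (trans (sym φ∅) φuv)) }
    ; proper    = φ-proper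
    ; light     = λ k → subst (_≤ℚ f) (cong ⟦_⟧ (sym (count-≡0 (edge? (newEdge? φ k)) pairs
                                                     λ { _ (_ , φ∅ , φuv) → nothing≢just (trans (sym φ∅) φuv) })))
                              0≤f
    }
    where
    nothing≢just : ∀ {k} → nothing ≢ just k
    nothing≢just ()

  module Properties {ψ : PartialColoring n} (valid : Valid ψ) where

    open Valid valid

    φ-or-new : ∀ {u v c} → ψ u v ≡ just c → φ u v ≡ just c ⊎ NewEdge ψ c u v
    φ-or-new {u} {v} {c} ψuv with φ u v in φuv
    ... | just j  = inj₁ (trans (sym (extends u v j φuv)) ψuv)
    ... | nothing = inj₂ (refl , ψuv)

    in-range : (∀ u v c → u ≢ v → φ u v ≡ just c → InRange 1 m c) →
               ∀ u v c → u ≢ v → ψ u v ≡ just c → InRange 1 m c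
    in-range φ-range u v c u≢v ψuv with φ-or-new ψuv
    ... | inj₁ φuv = φ-range u v c u≢v φuv
    ... | inj₂ new = proj₂ (proj₂ (proj₂ (new-edge u v c new)))

    degree-≤ : ∀ x → degree (colored? ψ) x ≤ degree (colored? φ) x + degree conflict? x
    degree-≤ x = count-⊎-≤ (incident? (colored? ψ) x) (incident? (colored? φ) x) (incident? conflict? x)
                           φ-or-conflict vertices
      where
      φ-or-conflict : ∀ w → Incident (Colored ψ) x w → Incident (Colored φ) x w ⊎ Incident (Conflict L h) x w
      φ-or-conflict w (w≢x , c , ψxw) with φ-or-new ψxw
      ... | inj₁ φxw = inj₁ (w≢x , c , φxw)
      ... | inj₂ new = inj₂ (w≢x , proj₁ (proj₂ (new-edge x w c new)))

    usedColours-≤ : ∀ x → count (usedAt? ψ x) colours ≤ degree (colored? ψ) x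
    usedColours-≤ x = ℕ.≤-trans
      (∑-mono-≤ colours λ k → 𝟙-any≤count (incident? (λ u v → ψ u v ≟ₘ just k) x) vertices)
      (∑-count-fibres-≤ (λ k → incident? (λ u v → ψ u v ≟ₘ just k) x) (incident? (colored? ψ) x) colours-unique
         (λ { k w (w≢x , ψxw) → w≢x , k , ψxw })
         (λ { k k′ w (_ , ψxw) (_ , ψxw′) → just-injective (trans (sym ψxw) ψxw′) })
         vertices)

    ∑newCount-≤ : ∑ colours (newCount ψ) ≤ edgeCount conflict?
    ∑newCount-≤ = ∑-count-fibres-≤ (λ k → edge? (newEdge? ψ k)) (edge? conflict?) colours-unique
      (λ { k (u , v) (u<v , new) → u<v , proj₁ (proj₂ (new-edge u v k new)) })
      (λ { k k′ (u , v) (_ , _ , ψuv) (_ , _ , ψuv′) → just-injective (trans (sym ψuv) ψuv′) })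
      pairs

    colourClass-≤ : ∀ k → edgeCount (λ u v → ψ u v ≟ₘ just k) ≤ edgeCount (λ u v → φ u v ≟ₘ just k) + newCount ψ k
    colourClass-≤ k = count-⊎-≤ (edge? (λ u v → ψ u v ≟ₘ just k)) (edge? (λ u v → φ u v ≟ₘ just k))
                                (edge? (newEdge? ψ k))
                                φ-or-new′ pairs
      where
      φ-or-new′ : ∀ e → Edge (λ u v → ψ u v ≡ just k) e → Edge (λ u v → φ u v ≡ just k) e ⊎ Edge (NewEdge ψ k) e
      φ-or-new′ (u , v) (u<v , ψuv) with φ-or-new ψuv
      ... | inj₁ φuv = inj₁ (u<v , φuv)
      ... | inj₂ new = inj₂ (u<v , new)

    hClass-≤ : ∀ {G : V n → V n → Set} (G? : ∀ u v → Dec (G u v)) k →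
               edgeCount (λ u v → G? u v ×-dec (colored? ψ u v ×-dec (h u v ℕ.≟ k))) ≤
               edgeCount (λ u v → G? u v ×-dec ((h u v ℕ.≟ k) ×-dec colored? φ u v)) +
               edgeCount (λ u v → G? u v ×-dec ((h u v ℕ.≟ k) ×-dec conflict? u v))
    hClass-≤ {G} G? k = count-⊎-≤ _ _ _ φ-or-conflict pairs
      where
      φ-or-conflict : ∀ e → Edge (λ u v → G u v × Colored ψ u v × h u v ≡ k) e →
                      Edge (λ u v → G u v × h u v ≡ k × Colored φ u v) e ⊎
                      Edge (λ u v → G u v × h u v ≡ k × Conflict L h u v) e
      φ-or-conflict (u , v) (u<v , g , (c , ψuv) , hk) with φ-or-new ψuv
      ... | inj₁ φuv = inj₁ (u<v , g , hk , c , φuv)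
      ... | inj₂ new = inj₂ (u<v , g , hk , proj₁ (proj₂ (new-edge u v c new)))

module Recolouring where

  open Counting
  open RationalBounds
  open import Data.Bool as Bool using (true; false)
  open import Data.List using (List; length; foldl; filter)
  open import Data.List.Membership.Propositional.Properties using (∈-filter⁺)
  open import Data.List.Relation.Unary.All as All using (All)
  open import Data.List.Relation.Unary.All.Properties using (all-filter)
  open import Data.Maybe using (just; nothing)
  open import Data.Nat as ℕ using (ℕ; _%_; _≡ᵇ_; s≤s; z≤n) renaming (_≤_ to _≤ℕ_)
  import Data.Nat.Properties as ℕ
  open import Data.Product using (∃; _×_; _,_; proj₁; proj₂)
  open import Data.Rational as ℚ using (ℚ; 0ℚ; 1ℚ; _≤_; _<_; _+_; _*_; _-_; _÷_; >-nonZero)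
  import Data.Rational.Properties as ℚ
  open import Data.Sum using (_⊎_; inj₁; inj₂)
  open import Relation.Nullary using (Dec; yes; no; ¬_; ¬?; contradiction)
  open import Relation.Nullary.Decidable using (_×-dec_; _⊎-dec_)
  open import Relation.Binary.PropositionalEquality

  mOf-bounds : ∀ {n} → 1 ≤ℕ n → 1 ≤ℕ mOf n × mOf n ≤ℕ 2 ℕ.* n
  mOf-bounds {n} 1≤n with n % 2 ≡ᵇ 0
  ... | true  = ℕ.∸-monoˡ-≤ 1 (ℕ.*-monoʳ-≤ 2 1≤n) , ℕ.m∸n≤m (2 ℕ.* n) 1
  ... | false = ℕ.≤-trans (s≤s z≤n) (ℕ.*-monoʳ-≤ 2 1≤n) , ℕ.≤-refl

  module Construction
    {n : ℕ} (1≤n : 1 ≤ℕ n) {α β C F : ℚ} (0<F : 0ℚ < F)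
    (slack : 1ℚ ≤ ((((⟦ mOf n ⟧ - β * ⟦ mOf n ⟧) - ⟦ 2 ⟧ * α * ⟦ mOf n ⟧) - ⟦ 2 ⟧ * C)
                   - _÷_ (⟦ 2 ℕ.* n ⟧ * C) F {{>-nonZero 0<F}}))
    {φ : PartialColoring n} (φ-pre : IsPrecoloring (mOf n) φ) (φ-dense : Dense (mOf n) α φ)
    {L : ListAssignment n} (L-list : IsListAssignment (mOf n) L) (L-sparse : Sparse (mOf n) β L)
    {h : TotalColoring n} (h-sym : ∀ u v → h u v ≡ h v u)
    (Knn-conflicts : ∀ (v : V n) → IncAtMost v (λ v w → Knn v w × Conflict L h v w) (C ÷ ⟦ 2 ⟧))
    (G-conflicts : ∀ s (v : V n) → side v ≡ s → IncAtMost v (λ v w → InG s v w × Conflict L h v w) (C ÷ ⟦ 2 ⟧))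
    where

    open VertexSet n
    open FirstFit n (mOf n) F φ L h (proj₁ L-list) h-sym

    M : ℚ
    M = ⟦ mOf n ⟧

    instance
      F≢0 : ℚ.NonZero F
      F≢0 = >-nonZero 0<F

      F>0 : ℚ.Positive F
      F>0 = ℚ.positive 0<F

    D : ℚ
    D = (⟦ 2 ℕ.* n ⟧ * C) ÷ F

    knn? : (u v : V n) → Dec (Knn u v)
    knn? u v = ¬? (side u Bool.≟ side v)

    inG? : ∀ s (u v : V n) → Dec (InG s u v)
    inG? s u v = (side u Bool.≟ s) ×-dec (side v Bool.≟ s)

    conflictDegree-≤ : ∀ x → ⟦ degree conflict? x ⟧ ≤ C
    conflictDegree-≤ x = subst (⟦ degree conflict? x ⟧ ≤_) (half+half C)
      (⟦⟧-≤-+ {degree conflict? x} {degree knnConflict? x} {degree sideConflict? x}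
              (count-⊎-≤ (incident? conflict? x) (incident? knnConflict? x) (incident? sideConflict? x)
                         across-or-inside vertices)
              (IncAtMost⇒degree≤ knnConflict? x (Knn-conflicts x))
              (IncAtMost⇒degree≤ sideConflict? x (G-conflicts (side x) x refl)))
      where
      knnConflict? : (u v : V n) → Dec (Knn u v × Conflict L h u v)
      knnConflict? u v = knn? u v ×-dec conflict? u v
      sideConflict? : (u v : V n) → Dec (InG (side x) u v × Conflict L h u v)
      sideConflict? u v = inG? (side x) u v ×-dec conflict? u v
      across-or-inside : ∀ w → Incident (Conflict L h) x w →
                         Incident (λ u v → Knn u v × Conflict L h u v) x w ⊎
                         Incident (λ u v → InG (side x) u v × Conflict L h u v) x w
      across-or-inside w (w≢x , conflict) with side x Bool.≟ side w
      ... | no  across = inj₁ (w≢x , across , conflict)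
      ... | yes inside = inj₂ (w≢x , (refl , sym inside) , conflict)

    degree-bound : ∀ {ψ} → Valid ψ → ∀ x → ⟦ degree (colored? ψ) x ⟧ ≤ α * M + C
    degree-bound {ψ} valid x =
      ⟦⟧-≤-+ {degree (colored? ψ) x} {degree (colored? φ) x} {degree conflict? x} (Properties.degree-≤ valid x)
             (IncAtMost⇒degree≤ (colored? φ) x (proj₂ φ-dense x)) (conflictDegree-≤ x)

    usedColours-bound : ∀ {ψ} → Valid ψ → ∀ x → ⟦ count (usedAt? ψ x) colours ⟧ ≤ α * M + C
    usedColours-bound {ψ} valid x =
      ℚ.≤-trans {⟦ count (usedAt? ψ x) colours ⟧} {⟦ degree (colored? ψ) x ⟧} {α * M + C}
        (⟦⟧-mono-≤ (Properties.usedColours-≤ valid x)) (degree-bound valid x)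

    module FreeColour {ψ : PartialColoring n} (valid : Valid ψ) {x y : V n} (x<y : x <ᵥ y)
                      (conflict : Conflict L h x y) where

      open Properties valid

      x≢y : x ≢ y
      x≢y = <ᵥ⇒≢ x<y

      1≤C : 1ℚ ≤ C
      1≤C = ℚ.≤-trans {1ℚ} {⟦ degree conflict? x ⟧} {C}
        (⟦⟧-mono-≤ {1} {degree conflict? x} (count-pos (incident? conflict? x) (∈-vertices y) ((λ y≡x → x≢y (sym y≡x)) , conflict)))
        (conflictDegree-≤ x)

      D+1≤M : D + 1ℚ ≤ M
      D+1≤M = subst (λ t → t + 1ℚ ≤ M) zeros
        (budget {M} {β} {α} {C} {D} (AtMost-nonNeg (proj₂ L-sparse x 0)) 0≤αM+C 0≤αM+C (ℚ.≤-refl {D}) slack)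
        where
        0≤αM+C : 0ℚ ≤ α * M + C
        0≤αM+C = ℚ.+-mono-≤ (AtMost-nonNeg (proj₂ φ-dense x)) (ℚ.≤-trans (ℚ.nonNegative⁻¹ 1ℚ) 1≤C)
        zeros : (0ℚ + 0ℚ) + (0ℚ + D) ≡ D
        zeros = trans (ℚ.+-identityˡ (0ℚ + D)) (ℚ.+-identityˡ D)

      M≤D*F : M ≤ D * F
      M≤D*F = begin
        M                    ≤⟨ ⟦⟧-mono-≤ (proj₂ (mOf-bounds 1≤n)) ⟩
        ⟦ 2 ℕ.* n ⟧          ≡⟨ ℚ.*-identityʳ ⟦ 2 ℕ.* n ⟧ ⟨
        ⟦ 2 ℕ.* n ⟧ * 1ℚ     ≤⟨ ℚ.*-monoˡ-≤-nonNeg ⟦ 2 ℕ.* n ⟧ {{ℚ.nonNegative (⟦⟧-mono-≤ {0} {2 ℕ.* n} z≤n)}} 1≤C ⟩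
        ⟦ 2 ℕ.* n ⟧ * C      ≡⟨ ÷-*-cancel (⟦ 2 ℕ.* n ⟧ * C) F ⟨
        D * F                ∎
        where open ℚ.≤-Reasoning

      -- xy is a conflict edge, so c ≥ 1; then D·f = 2nc ≥ 2n ≥ m ≥ D + 1 forces f ≥ 1.
      1≤F : 1ℚ ≤ F
      1≤F = one≤weight {F} {M} {D} (ℚ.<⇒≤ 0<F) (⟦⟧-mono-≤ {1} {mOf n} (proj₁ (mOf-bounds 1≤n))) D+1≤M M≤D*F

      listed usedAtX usedAtY saturated forbidden : ℕ
      listed    = count (λ k → L x y k Bool.≟ true) colours
      usedAtX   = count (usedAt? ψ x) colours
      usedAtY   = count (usedAt? ψ y) colours
      saturated = count (saturated? ψ) colours
      forbidden = count (forbidden? ψ x y) colours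

      listed-bound : ⟦ listed ⟧ ≤ β * M
      listed-bound = AtMost⇒count≤ (λ k → L x y k Bool.≟ true) colours-unique (proj₁ L-sparse x y x≢y)

      saturated-bound : ⟦ saturated ⟧ ≤ D
      saturated-bound = ℚ.*-cancelʳ-≤-pos F (begin
        ⟦ saturated ⟧ * F                     ≤⟨ count-saturated 1≤F (newCount ψ) colours ⟩
        ⟦ 2 ℕ.* ∑ colours (newCount ψ) ⟧      ≤⟨ ⟦⟧-mono-≤ {2 ℕ.* ∑ colours (newCount ψ)} {∑ vertices (degree conflict?)}
                                                   (ℕ.≤-trans (ℕ.*-monoʳ-≤ 2 ∑newCount-≤) (handshake conflict? Conflict-sym)) ⟩
        ⟦ ∑ vertices (degree conflict?) ⟧     ≤⟨ ⟦∑⟧≤length* (degree conflict?) conflictDegree-≤ vertices ⟩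
        ⟦ length vertices ⟧ * C               ≡⟨ cong (λ l → ⟦ l ⟧ * C) length-vertices ⟩
        ⟦ 2 ℕ.* n ⟧ * C                       ≡⟨ ÷-*-cancel (⟦ 2 ℕ.* n ⟧ * C) F ⟨
        D * F                                 ∎)
        where open ℚ.≤-Reasoning

      forbidden-≤ : forbidden ≤ℕ (listed ℕ.+ usedAtX) ℕ.+ (usedAtY ℕ.+ saturated)
      forbidden-≤ = ℕ.≤-trans
        (count-⊎-≤ (forbidden? ψ x y) (λ k → (L x y k Bool.≟ true) ⊎-dec usedAt? ψ x k)
                   (λ k → usedAt? ψ y k ⊎-dec saturated? ψ k) (λ _ reason → reason) colours)
        (ℕ.+-mono-≤ (count-⊎-≤ _ (λ k → L x y k Bool.≟ true) (usedAt? ψ x) (λ _ reason → reason) colours)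
                    (count-⊎-≤ _ (usedAt? ψ y) (saturated? ψ) (λ _ reason → reason) colours))

      forbidden+1≤M : ⟦ forbidden ℕ.+ 1 ⟧ ≤ M
      forbidden+1≤M = begin
        ⟦ forbidden ℕ.+ 1 ⟧                                              ≡⟨ ⟦⟧-+ forbidden 1 ⟩
        ⟦ forbidden ⟧ + 1ℚ                                               ≤⟨ ℚ.+-monoˡ-≤ 1ℚ
            (⟦⟧-≤-+ {forbidden} {listed ℕ.+ usedAtX} {usedAtY ℕ.+ saturated} forbidden-≤
                    (⟦⟧-+-≤ listed usedAtX) (⟦⟧-+-≤ usedAtY saturated)) ⟩
        (⟦ listed ⟧ + ⟦ usedAtX ⟧) + (⟦ usedAtY ⟧ + ⟦ saturated ⟧) + 1ℚ ≤⟨ budget {M} {β} {α} {C} {D} listed-bound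
            (usedColours-bound valid x) (usedColours-bound valid y) saturated-bound slack ⟩
        M                                                                ∎
        where
        open ℚ.≤-Reasoning
        ⟦⟧-+-≤ : ∀ p q → ⟦ p ℕ.+ q ⟧ ≤ ⟦ p ⟧ + ⟦ q ⟧
        ⟦⟧-+-≤ p q = ℚ.≤-reflexive (⟦⟧-+ p q)

      forbidden<colours : forbidden ℕ.< length colours
      forbidden<colours = subst₂ ℕ._≤_ (ℕ.+-comm forbidden 1) (sym length-colours)
                                 (⟦⟧-cancel-≤ {forbidden ℕ.+ 1} {mOf n} forbidden+1≤M)

    never-stuck : NeverStuck
    never-stuck {ψ} valid {x} {y} x<y conflict _ =
      count<length⇒∃¬ (forbidden? ψ x y) colours (FreeColour.forbidden<colours valid x<y conflict)

    pending : List (V n × V n)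
    pending = filter (edge? conflict?) pairs

    recolouring : PartialColoring n
    recolouring = foldl step φ pending

    private
      run : Valid recolouring × All (Covered recolouring) pending
      run = run-valid never-stuck (φ-valid φ-pre (ℚ.<⇒≤ 0<F)) pending (all-filter (edge? conflict?) pairs)

    recolouring-valid : Valid recolouring
    recolouring-valid = proj₁ run

    open Valid recolouring-valid
    open Properties recolouring-valid

    recolouring-extends : ∀ u v k → φ u v ≡ just k → recolouring u v ≡ just k
    recolouring-extends = extends

    recolouring-precoloring : IsPrecoloring (mOf n) recolouring
    recolouring-precoloring = symmetric , in-range (proj₁ (proj₂ φ-pre)) , proper

    uncoloured⇒≡nothing : ∀ {ψ : PartialColoring n} {u v} → ¬ Colored ψ u v → ψ u v ≡ nothing
    uncoloured⇒≡nothing {ψ} {u} {v} ¬c with ψ u v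
    ... | just c  = contradiction (c , refl) ¬c
    ... | nothing = refl

    covers-ordered : ∀ {u v} → u <ᵥ v → Conflict L h u v → φ u v ≡ nothing →
                     ∃ λ k → recolouring u v ≡ just k × L u v k ≡ false
    covers-ordered {u} {v} u<v conflict φ∅ =
      with-colour (All.lookup (proj₂ run) (∈-filter⁺ (edge? conflict?) (∈-pairs (u , v)) (u<v , conflict)))
      where
      with-colour : Colored recolouring u v → ∃ λ k → recolouring u v ≡ just k × L u v k ≡ false
      with-colour (k , ψuv) = k , ψuv , proj₁ (proj₂ (proj₂ (new-edge u v k (φ∅ , ψuv))))

    recolouring-covers : ∀ u v → u ≢ v → Conflict L h u v → ¬ Colored φ u v →
                         ∃ λ k → recolouring u v ≡ just k × L u v k ≡ false
    recolouring-covers u v u≢v conflict uncoloured = by-order (≢⇒<ᵥ⊎>ᵥ u≢v)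
      where
      φ∅ : φ u v ≡ nothing
      φ∅ = uncoloured⇒≡nothing {φ} {u} {v} uncoloured
      by-order : u <ᵥ v ⊎ v <ᵥ u → ∃ λ k → recolouring u v ≡ just k × L u v k ≡ false
      by-order (inj₁ u<v) = covers-ordered u<v conflict φ∅
      by-order (inj₂ v<u) =
        let (k , ψvu , Lvuk) = covers-ordered v<u (Conflict-sym u v conflict) (trans (sym (proj₁ φ-pre u v)) φ∅)
        in k , trans (symmetric u v) ψvu , trans (proj₁ L-list u v k) Lvuk

    recolouring-degree : ∀ v → IncAtMost v (Colored recolouring) (α * M + C)
    recolouring-degree v = degree≤⇒IncAtMost (colored? recolouring) v (degree-bound recolouring-valid v)

    recolouring-colourClass : ∀ k → EdgeAtMost (λ u v → recolouring u v ≡ just k) (α * M + F)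
    recolouring-colourClass k = edgeCount≤⇒EdgeAtMost ψ≡k?
      (⟦⟧-≤-+ {edgeCount ψ≡k?} {edgeCount φ≡k?} {newCount recolouring k} (colourClass-≤ k)
              (EdgeAtMost⇒edgeCount≤ φ≡k? (proj₁ φ-dense k)) (light k))
      where
      ψ≡k? : (u v : V n) → Dec (recolouring u v ≡ just k)
      ψ≡k? u v = recolouring u v ≟ₘ just k
      φ≡k? : (u v : V n) → Dec (φ u v ≡ just k)
      φ≡k? u v = φ u v ≟ₘ just k

    recolouring-hClass : ∀ {G : V n → V n → Set} (G? : ∀ u v → Dec (G u v)) {k} →
                         EdgeAtMost (λ u v → G u v × h u v ≡ k × Conflict L h u v) C →
                         EdgeAtMost (λ u v → G u v × h u v ≡ k × Colored φ u v) C →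
                         EdgeAtMost (λ u v → G u v × Colored recolouring u v × h u v ≡ k) (⟦ 2 ⟧ * C)
    recolouring-hClass {G} G? {k} conflicts precoloured = edgeCount≤⇒EdgeAtMost recoloured?
      (subst (⟦ edgeCount recoloured? ⟧ ≤_) (c+c≡2c C)
        (⟦⟧-≤-+ {edgeCount recoloured?} {edgeCount precoloured?} {edgeCount conflicting?} (hClass-≤ G? k)
                (EdgeAtMost⇒edgeCount≤ precoloured? precoloured) (EdgeAtMost⇒edgeCount≤ conflicting? conflicts)))
      where
      recoloured? : (u v : V n) → Dec (G u v × Colored recolouring u v × h u v ≡ k)
      recoloured? u v = G? u v ×-dec (colored? recolouring u v ×-dec (h u v ℕ.≟ k))
      precoloured? : (u v : V n) → Dec (G u v × h u v ≡ k × Colored φ u v)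
      precoloured? u v = G? u v ×-dec ((h u v ℕ.≟ k) ×-dec colored? φ u v)
      conflicting? : (u v : V n) → Dec (G u v × h u v ≡ k × Conflict L h u v)
      conflicting? u v = G? u v ×-dec ((h u v ℕ.≟ k) ×-dec conflict? u v)

open import Data.Nat using (ℕ; _+_; _*_; _/_) renaming (_≤_ to _≤ℕ_)
open import Data.Rational using (ℚ; _-_; _≤_; _<_; _÷_; 0ℚ; 1ℚ) renaming (_+_ to _+q_; _*_ to _*q_)
open import Data.Rational using (>-nonZero)
open import Data.Bool using (Bool; true; false)
open import Data.Maybe using (just)
open import Data.Product using (Σ; _×_; _,_; ∃)
open import Relation.Nullary using (¬_)
open import Relation.Binary.PropositionalEquality using (_≡_; _≢_)

open import Data.Product using (proj₁)

lemma3p4 : (n : ℕ) → 1 ≤ℕ n →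
  (α β ε : ℚ) (c f : ℕ → ℚ) (fpos : 0ℚ < f n) →
  let m = mOf n in
  1ℚ ≤ ((((⟦ m ⟧ - β *q ⟦ m ⟧) - ⟦ 2 ⟧ *q α *q ⟦ m ⟧) - ⟦ 2 ⟧ *q c n)
          - _÷_ (⟦ 2 * n ⟧ *q c n) (f n) {{>-nonZero fpos}}) →
  (φ : PartialColoring n) → IsPrecoloring m φ → Dense m α φ →
  (L : ListAssignment n) → IsListAssignment m L → Sparse m β L →
  (∀ (u v : V n) k → u ≢ v → φ u v ≡ just k → L u v k ≡ false) →
  (h : TotalColoring n) → IsProperColoring m h →
  (∀ (u v : V n) → u ≢ v → Knn u v → InRange 1 n (h u v)) →
  (∀ (s : Bool) (u v : V n) → u ≢ v → InG s u v → InRange (n + 1) m (h u v)) →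
  -- (a)
  EdgeAtMost (λ u v → Knn u v ×
      ¬ InManyGoodCycles m L h u v (⟦ n / 2 ⟧ - ε *q ⟦ n ⟧))
    ⟦ 3 * n + 7 ⟧ →
  -- (b)
  (∀ (v : V n) → IncAtMost v (λ v w → Knn v w × Conflict L h v w) (c n ÷ ⟦ 2 ⟧)) →
  -- (c)
  (∀ k → InRange 1 n k →
    EdgeAtMost (λ u v → Knn u v × h u v ≡ k × Conflict L h u v) (c n)) →
  -- (d)
  (∀ k → InRange 1 n k →
    EdgeAtMost (λ u v → Knn u v × h u v ≡ k × Colored φ u v) (c n)) →
  -- (e)
  (∀ k₁ k₂ → InRange 1 m k₁ → InRange 1 n k₂ →
    EdgeAtMost (λ u v → Knn u v × h u v ≡ k₂ × L u v k₁ ≡ true) (c n)) →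
  -- (f)
  (∀ (s : Bool) (v : V n) → side v ≡ s →
    IncAtMost v (λ v w → InG s v w × Conflict L h v w) (c n ÷ ⟦ 2 ⟧)) →
  -- (g)
  (∀ (s : Bool) k → InRange (n + 1) m k →
    EdgeAtMost (λ u v → InG s u v × h u v ≡ k × Conflict L h u v) (c n)) →
  -- (h)
  (∀ (s : Bool) k → InRange (n + 1) m k →
    EdgeAtMost (λ u v → InG s u v × h u v ≡ k × Colored φ u v) (c n)) →
  -- (i)
  (∀ (s : Bool) k₁ k₂ → InRange 1 m k₁ → InRange (n + 1) m k₂ →
    EdgeAtMost (λ u v → InG s u v × h u v ≡ k₂ × L u v k₁ ≡ true) (c n)) →
  Σ (PartialColoring n) λ φ' → IsPrecoloring m φ' ×
    -- (1)
    (∀ (u v : V n) k → u ≢ v → φ u v ≡ just k → φ' u v ≡ just k) ×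
    -- (2)
    (∀ (u v : V n) → u ≢ v → Conflict L h u v → ¬ Colored φ u v →
      ∃ λ k → φ' u v ≡ just k × L u v k ≡ false) ×
    -- (3)
    (∀ (v : V n) → IncAtMost v (Colored φ') (α *q ⟦ m ⟧ +q c n)) ×
    -- (4)
    (∀ k → InRange 1 m k →
      EdgeAtMost (λ u v → φ' u v ≡ just k) (α *q ⟦ m ⟧ +q f n)) ×
    -- (5)
    (∀ k → InRange 1 n k →
      EdgeAtMost (λ u v → Knn u v × Colored φ' u v × h u v ≡ k) (⟦ 2 ⟧ *q c n)) ×
    -- (6)
    (∀ (s : Bool) k → InRange (n + 1) m k →
      EdgeAtMost (λ u v → InG s u v × Colored φ' u v × h u v ≡ k) (⟦ 2 ⟧ *q c n))
lemma3p4 n 1≤n α β _ c f 0<f slack φ φ-pre φ-dense L L-list L-sparse _ h h-proper _ _ _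
         Knn-conflicts Knn-conflict-classes Knn-precoloured-classes _
         G-conflicts G-conflict-classes G-precoloured-classes _ =
  recolouring , recolouring-precoloring ,
  (λ u v k _ → recolouring-extends u v k) ,
  recolouring-covers ,
  recolouring-degree ,
  (λ k _ → recolouring-colourClass k) ,
  (λ k k∈ → recolouring-hClass knn? (Knn-conflict-classes k k∈) (Knn-precoloured-classes k k∈)) ,
  (λ s k k∈ → recolouring-hClass (inG? s) (G-conflict-classes s k k∈) (G-precoloured-classes s k k∈))
  where
  open Recolouring.Construction 1≤n {α} {β} {c n} {f n} 0<f slack φ-pre φ-dense L-list L-sparse
                                (proj₁ h-proper) Knn-conflicts G-conflicts
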